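{- Let $\Lambda$ be a linear order and $\alpha\in|\Lambda|$. For every non-empty worm $A\in\mathbb{W}_{\alpha+1}$, every worm $B$, and every integer $n\ge1$, $\mathsf{GLP}_\Lambda\vdash A\alpha B\leftrightarrow A\alpha^nB$.
   Context: $\mathsf{GLP}_\Lambda$ is the modal logic with modalities $[\alpha]$, $\alpha\in|\Lambda|$, $\langle\alpha\rangle:=\neg[\alpha]\neg$, axiomatized by propositional tautologies and, for all $\alpha,\beta$: (i) $[\alpha](\chi\to\psi)\to([\alpha]\chi\to[\alpha]\psi)$; (ii) $[\alpha]([\alpha]\chi\to\chi)\to[\alpha]\chi$; (iii) $[\alpha]\chi\to[\beta][\alpha]\chi$ for $\alpha\le\beta$; (iv) $\langle\alpha\rangle\chi\to[\beta]\langle\alpha\rangle\chi$ for $\alpha<\beta$; (v) $[\alpha]\chi\to[\beta]\chi$ for $\alpha\le\beta$; with modus ponens and necessitation. A worm is a formula $\langle\alpha_1\rangle\cdots\langle\alpha_n\rangle\top$ ($n\ge0$), identified with the string $\alpha_1\cdots\alpha_n$. $A\alpha B$ denotes the concatenated string $A$, $\alpha$, $B$, and $\alpha^n$ the string of $n$ copies of $\alpha$. $\mathbb{W}_{\alpha+1}$ is the set of worms all of whose modals are strictly greater than $\alpha$. -}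

module Defs where

open import Level using (Level)
open import Data.Nat using (ℕ; zero; suc)
open import Data.Bool using (Bool; true; false; not; _∧_; _∨_)
open import Data.List using (List; []; _∷_; _++_; replicate)
open import Data.List.Relation.Unary.All using (All)
open import Data.Sum using (_⊎_)
open import Data.Product using (_×_)
open import Relation.Binary.PropositionalEquality using (_≡_)
open import Relation.Binary.Bundles using (StrictTotalOrder)

module GLP {c ℓ₁ ℓ₂ : Level} (Λ : StrictTotalOrder c ℓ₁ ℓ₂) where
  open StrictTotalOrder Λ renaming (Carrier to Ord)

  _≤Λ_ : Ord → Ord → Set _
  α ≤Λ β = (α < β) ⊎ (α ≈ β)

  infixr 5 _⇒_
  data Fm : Set c where
    var : ℕ → Fm
    ⊥'  : Fm
    _⇒_ : Fm → Fm → Fm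
    [_]_ : Ord → Fm → Fm

  ¬' : Fm → Fm
  ¬' φ = φ ⇒ ⊥'

  ⊤' : Fm
  ⊤' = ¬' ⊥'

  ⟨_⟩_ : Ord → Fm → Fm
  ⟨ α ⟩ φ = ¬' ([ α ] ¬' φ)

  _∧'_ : Fm → Fm → Fm
  φ ∧' ψ = ¬' (φ ⇒ ¬' ψ)

  _⇔_ : Fm → Fm → Fm
  φ ⇔ ψ = (φ ⇒ ψ) ∧' (ψ ⇒ φ)

  -- Propositional tautologies: modal subformulas [α]φ are treated as atoms.
  eval : (ℕ → Bool) → (Ord → Fm → Bool) → Fm → Bool
  eval v b (var n) = v n
  eval v b ⊥' = false
  eval v b (φ ⇒ ψ) = not (eval v b φ) ∨ eval v b ψ
  eval v b ([ α ] φ) = b α φ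

  Tautology : Fm → Set c
  Tautology φ = ∀ (v : ℕ → Bool) (b : Ord → Fm → Bool) → eval v b φ ≡ true

  data ⊢_ : Fm → Set (c Level.⊔ ℓ₁ Level.⊔ ℓ₂) where
    taut : ∀ {φ} → Tautology φ → ⊢ φ
    axK  : ∀ α χ ψ → ⊢ ([ α ] (χ ⇒ ψ) ⇒ ([ α ] χ ⇒ [ α ] ψ))
    axL  : ∀ α χ → ⊢ ([ α ] ([ α ] χ ⇒ χ) ⇒ [ α ] χ)
    ax3  : ∀ α β χ → α ≤Λ β → ⊢ ([ α ] χ ⇒ [ β ] [ α ] χ)
    ax4  : ∀ α β χ → α < β → ⊢ (⟨ α ⟩ χ ⇒ [ β ] ⟨ α ⟩ χ)
    ax5  : ∀ α β χ → α ≤Λ β → ⊢ ([ α ] χ ⇒ [ β ] χ)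
    mp   : ∀ {φ ψ} → ⊢ (φ ⇒ ψ) → ⊢ φ → ⊢ ψ
    nec  : ∀ {φ} α → ⊢ φ → ⊢ ([ α ] φ)

  Worm : Set c
  Worm = List Ord

  worm : Worm → Fm
  worm [] = ⊤'
  worm (α ∷ A) = ⟨ α ⟩ worm A

  -- A ∈ 𝕎_{α+1}: all modals strictly greater than α.
  InW> : Ord → Worm → Set _
  InW> α A = All (α <_) A

-- Let β be the last modality of A; since α < β, axioms (iv) and (v) give ⟨β⟩φ → ⟨β⟩⟨α⟩φ,
-- so under ⟨β⟩ one α can be pumped up to αⁿ. Conversely, axiom (iii) with β = α makes ⟨α⟩
-- transitive, ⟨α⟩⟨α⟩φ → ⟨α⟩φ, which collapses αⁿ back to α. Worms are monotone in their
-- tails, so both implications lift through the prefix A.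
module Submission where

open import Defs
open import Level using (Level)
open import Data.Nat using (ℕ; suc; zero)
open import Data.Bool using (Bool; true; false; not; _∨_)
open import Data.List using ([]; _∷_; _++_; replicate)
open import Data.List.Relation.Unary.All using (_∷_)
open import Data.Sum using (inj₁; inj₂)
open import Relation.Binary.Bundles using (StrictTotalOrder)
open import Relation.Binary.PropositionalEquality using (_≢_; _≡_; refl)

-- Matches the clause of `eval` for `_⇒_` definitionally, so truth tables close by refl.
_⇒ᵇ_ : Bool → Bool → Bool
x ⇒ᵇ y = not x ∨ y

infixr 5 _⇒ᵇ_

module GLP-Derived {c ℓ₁ ℓ₂ : Level} (Λ : StrictTotalOrder c ℓ₁ ℓ₂) where
  open GLP Λ
  open StrictTotalOrder Λ renaming (Carrier to Ord)

  ⊢-refl : ∀ p → ⊢ (p ⇒ p)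
  ⊢-refl p = taut λ v b → refl-ᵇ (eval v b p)
    where
    refl-ᵇ : ∀ x → (x ⇒ᵇ x) ≡ true
    refl-ᵇ true  = refl
    refl-ᵇ false = refl

  ⊢-trans : ∀ {p q r} → ⊢ (p ⇒ q) → ⊢ (q ⇒ r) → ⊢ (p ⇒ r)
  ⊢-trans {p} {q} {r} p⇒q q⇒r =
    mp (mp (taut λ v b → trans-ᵇ (eval v b p) (eval v b q) (eval v b r)) p⇒q) q⇒r
    where
    trans-ᵇ : ∀ x y z → ((x ⇒ᵇ y) ⇒ᵇ (y ⇒ᵇ z) ⇒ᵇ x ⇒ᵇ z) ≡ true
    trans-ᵇ true  true  true  = refl
    trans-ᵇ true  true  false = refl
    trans-ᵇ true  false _     = refl
    trans-ᵇ false true  true  = refl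
    trans-ᵇ false true  false = refl
    trans-ᵇ false false _     = refl

  ⊢-contrapose : ∀ {p q} → ⊢ (p ⇒ q) → ⊢ (¬' q ⇒ ¬' p)
  ⊢-contrapose {p} {q} p⇒q = mp (taut λ v b → contrapose-ᵇ (eval v b p) (eval v b q)) p⇒q
    where
    contrapose-ᵇ : ∀ x y → ((x ⇒ᵇ y) ⇒ᵇ (y ⇒ᵇ false) ⇒ᵇ x ⇒ᵇ false) ≡ true
    contrapose-ᵇ true  true  = refl
    contrapose-ᵇ true  false = refl
    contrapose-ᵇ false true  = refl
    contrapose-ᵇ false false = refl

  ⊢-⇔-intro : ∀ {p q} → ⊢ (p ⇒ q) → ⊢ (q ⇒ p) → ⊢ (p ⇔ q)
  ⊢-⇔-intro {p} {q} p⇒q q⇒p =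
    mp (mp (taut λ v b → ⇔-intro-ᵇ (eval v b p) (eval v b q)) p⇒q) q⇒p
    where
    ⇔-intro-ᵇ : ∀ x y →
      ((x ⇒ᵇ y) ⇒ᵇ (y ⇒ᵇ x) ⇒ᵇ ((x ⇒ᵇ y) ⇒ᵇ (y ⇒ᵇ x) ⇒ᵇ false) ⇒ᵇ false) ≡ true
    ⇔-intro-ᵇ true  true  = refl
    ⇔-intro-ᵇ true  false = refl
    ⇔-intro-ᵇ false true  = refl
    ⇔-intro-ᵇ false false = refl

  ⊢-⇒-absorb : ∀ {p x q} → ⊢ (p ⇒ x) → ⊢ (x ⇒ p ⇒ q) → ⊢ (p ⇒ q)
  ⊢-⇒-absorb {p} {x} {q} p⇒x x⇒p⇒q =
    mp (mp (taut λ v b → absorb-ᵇ (eval v b p) (eval v b x) (eval v b q)) p⇒x) x⇒p⇒q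
    where
    absorb-ᵇ : ∀ x y z → ((x ⇒ᵇ y) ⇒ᵇ (y ⇒ᵇ x ⇒ᵇ z) ⇒ᵇ x ⇒ᵇ z) ≡ true
    absorb-ᵇ true  true  true  = refl
    absorb-ᵇ true  true  false = refl
    absorb-ᵇ true  false _     = refl
    absorb-ᵇ false true  true  = refl
    absorb-ᵇ false true  false = refl
    absorb-ᵇ false false _     = refl

  □-mono : ∀ {p q} α → ⊢ (p ⇒ q) → ⊢ ([ α ] p ⇒ [ α ] q)
  □-mono {p} {q} α p⇒q = mp (axK α p q) (nec α p⇒q)

  ◇-mono : ∀ {p q} α → ⊢ (p ⇒ q) → ⊢ (⟨ α ⟩ p ⇒ ⟨ α ⟩ q)
  ◇-mono α p⇒q = ⊢-contrapose (□-mono α (⊢-contrapose p⇒q))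

  □-◇-conj : ∀ β χ ψ → ⊢ ([ β ] χ ⇒ ⟨ β ⟩ ψ ⇒ ⟨ β ⟩ χ)
  □-◇-conj β χ ψ = mp (taut λ v b → rearrange-ᵇ (b β χ) (b β (¬' χ)) (b β (¬' ψ)))
                      (⊢-trans (□-mono β (taut λ v b → explode-ᵇ (eval v b χ) (eval v b ψ)))
                               (axK β (¬' χ) (¬' ψ)))
    where
    explode-ᵇ : ∀ x y → (x ⇒ᵇ (x ⇒ᵇ false) ⇒ᵇ y ⇒ᵇ false) ≡ true
    explode-ᵇ true  true  = refl
    explode-ᵇ true  false = refl
    explode-ᵇ false true  = refl
    explode-ᵇ false false = refl
    rearrange-ᵇ : ∀ x y z →
      ((x ⇒ᵇ y ⇒ᵇ z) ⇒ᵇ x ⇒ᵇ (z ⇒ᵇ false) ⇒ᵇ y ⇒ᵇ false) ≡ true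
    rearrange-ᵇ true  true  true  = refl
    rearrange-ᵇ true  true  false = refl
    rearrange-ᵇ true  false true  = refl
    rearrange-ᵇ true  false false = refl
    rearrange-ᵇ false true  true  = refl
    rearrange-ᵇ false true  false = refl
    rearrange-ᵇ false false true  = refl
    rearrange-ᵇ false false false = refl

  ◇-trans : ∀ α φ → ⊢ (⟨ α ⟩ ⟨ α ⟩ φ ⇒ ⟨ α ⟩ φ)
  ◇-trans α φ = ⊢-contrapose (⊢-trans (ax3 α α (¬' φ) (inj₂ Eq.refl))
                                      (□-mono α (taut λ v b → ¬¬-intro-ᵇ (b α (¬' φ)))))
    where
    ¬¬-intro-ᵇ : ∀ x → (x ⇒ᵇ (x ⇒ᵇ false) ⇒ᵇ false) ≡ true
    ¬¬-intro-ᵇ true  = refl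
    ¬¬-intro-ᵇ false = refl

  ◇-antitone : ∀ {α β} φ → α ≤Λ β → ⊢ (⟨ β ⟩ φ ⇒ ⟨ α ⟩ φ)
  ◇-antitone {α} {β} φ α≤β = ⊢-contrapose (ax5 α β (¬' φ) α≤β)

  -- ⟨β⟩ψ yields ⟨α⟩ψ, which is boxed by (iv); the box then combines with ⟨β⟩ψ.
  ◇-insert : ∀ {α β} ψ → α < β → ⊢ (⟨ β ⟩ ψ ⇒ ⟨ β ⟩ ⟨ α ⟩ ψ)
  ◇-insert {α} {β} ψ α<β =
    ⊢-⇒-absorb (⊢-trans (◇-antitone ψ (inj₁ α<β)) (ax4 α β ψ α<β)) (□-◇-conj β (⟨ α ⟩ ψ) ψ)

  worm-++-mono : ∀ A {X Y} → ⊢ (worm X ⇒ worm Y) → ⊢ (worm (A ++ X) ⇒ worm (A ++ Y))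
  worm-++-mono []      X⇒Y = X⇒Y
  worm-++-mono (β ∷ A) X⇒Y = ◇-mono β (worm-++-mono A X⇒Y)

  worm-replicate-collapse : ∀ α B n → ⊢ (worm (replicate (suc n) α ++ B) ⇒ worm (α ∷ B))
  worm-replicate-collapse α B zero    = ⊢-refl _
  worm-replicate-collapse α B (suc n) =
    ⊢-trans (◇-mono α (worm-replicate-collapse α B n)) (◇-trans α (worm B))

  ◇-worm-replicate-expand : ∀ {α β} B n → α < β →
    ⊢ (⟨ β ⟩ worm (α ∷ B) ⇒ ⟨ β ⟩ worm (replicate (suc n) α ++ B))
  ◇-worm-replicate-expand B zero    α<β = ⊢-refl _
  ◇-worm-replicate-expand B (suc n) α<β =
    ⊢-trans (◇-worm-replicate-expand B n α<β) (◇-insert _ α<β)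

  -- Only the last modality of the prefix needs to exceed α.
  worm-replicate-expand : ∀ {α} β A → InW> α (β ∷ A) → ∀ B n →
    ⊢ (worm (β ∷ A ++ α ∷ B) ⇒ worm (β ∷ A ++ replicate (suc n) α ++ B))
  worm-replicate-expand β []      (α<β ∷ _)  B n = ◇-worm-replicate-expand B n α<β
  worm-replicate-expand β (γ ∷ A) (_ ∷ α<γA) B n = ◇-mono β (worm-replicate-expand γ A α<γA B n)

mainTheorem14 : ∀ {c ℓ₁ ℓ₂ : Level} (Λ : StrictTotalOrder c ℓ₁ ℓ₂) →
    let open GLP Λ in
    (α : StrictTotalOrder.Carrier Λ) (A : Worm) → A ≢ [] → InW> α A → (B : Worm) (n : ℕ) →
    ⊢ (worm (A ++ α ∷ B) ⇔ worm (A ++ replicate (suc n) α ++ B))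
mainTheorem14 Λ α []      A≢[] _    B n with () ← A≢[] refl
mainTheorem14 Λ α (β ∷ A) _    α<βA B n =
  ⊢-⇔-intro (worm-replicate-expand β A α<βA B n)
            (worm-++-mono (β ∷ A) (worm-replicate-collapse α B n))
  where open GLP-Derived Λ
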